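{- Let $a,r,m$ be integers with $a\ge 2$ and $m>0$. Let $g=\gcd(r,m)$ and $h=\gcd(l_a(g_a),m)$. If there is an integer $n\equiv r\pmod m$ that is a base-$a$ pseudoprime, then $h\mid r-1$, $g/g_a\mid a$, and, in the case that $g$ is even, there is an integer $k\equiv r\pmod m$ with Jacobi symbol $(a/k_{2a})=1$.
   Context: A base-$a$ pseudoprime is a composite positive integer $n$ with $a^n\equiv a\pmod n$. For integers $c\ne 0$ and $k\ge1$, $k_c$ denotes the largest divisor of $k$ coprime to $c$ (so $k_{2a}$ is the largest odd divisor of $k$ coprime to $a$). For positive coprime integers $a,k$, $l_a(k)$ denotes the multiplicative order of $a$ modulo $k$ (with $l_a(1)=1$). -}

module Defs where

open import Data.Nat as ℕ using (ℕ; zero; suc; _<_; _≤_)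
open import Data.Nat.Properties using (anyUpTo?)
open import Data.Nat.Primality using (Composite)
open import Data.Nat.Primality.Factorisation using (factorise; factors)
open import Data.Nat.Coprimality using (Coprime)
import Data.Nat.Divisibility as ℕD
open import Data.Integer as ℤ using (ℤ; +_; _-_; _^_; 0ℤ; 1ℤ; -1ℤ)
open import Data.Integer.Divisibility using (_∣_)
open import Data.List using (map; foldr)
open import Data.Product using (Σ; ∃; _×_; _,_)
open import Relation.Nullary using (yes; no; Dec)
open import Relation.Binary.PropositionalEquality using (_≡_)

infix 4 _≡_[mod_]
_≡_[mod_] : ℤ → ℤ → ℕ → Set
x ≡ y [mod m ] = (+ m) ∣ (x - y)

-- n is a base-a pseudoprime: n is a composite positive integer with a^n ≡ a (mod n).
-- (stdlib's Composite k: k has a divisor d with 1 < d < k, so k ≥ 4 > 0.)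
Pseudoprime : ℤ → ℤ → Set
Pseudoprime a n = Σ ℕ λ k → (n ≡ + k) × Composite k × ((a ^ k) ≡ a [mod k ])

-- d = k_c : the largest divisor of k coprime to c (k ≥ 1; c ≠ 0 given by its absolute value).
IsCoprimePart : (c k d : ℕ) → Set
IsCoprimePart c k d =
  ℕD._∣_ d k × Coprime d c × (∀ e → ℕD._∣_ e k → Coprime e c → e ≤ d)

-- t = l_a(k) : the multiplicative order of a modulo k (least t ≥ 1 with a^t ≡ 1 mod k).
IsOrder : (a k t : ℕ) → Set
IsOrder a k t =
  1 ≤ t × (((+ a) ^ t) ≡ 1ℤ [mod k ]) × (∀ s → 1 ≤ s → ((+ a) ^ s) ≡ 1ℤ [mod k ] → t ≤ s)

QR : ℤ → ℕ → Set
QR a p = ∃ λ x → x < p × ((+ x) ℤ.* (+ x) ≡ a [mod p ])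

QR? : ∀ a p → Dec (QR a p)
QR? a p = anyUpTo? (λ x → p ℕD.∣? ℤ.∣ (+ x) ℤ.* (+ x) - a ∣) p
-- note: (+ p) ∣ z is by definition p ∣ ∣ z ∣ on naturals, so ℕ's _∣?_ decides it

legendre : ℤ → ℕ → ℤ
legendre a p with p ℕD.∣? ℤ.∣ a ∣
... | yes _ = 0ℤ
... | no _ with QR? a p
...   | yes _ = 1ℤ
...   | no _ = -1ℤ

-- Jacobi symbol (a/n) for n ≥ 1: product of Legendre symbols over the prime
-- factorisation of n (with multiplicity); (a/1) = 1.  Value at n = 0 is a dummy.
jacobi : ℤ → ℕ → ℤ
jacobi a zero = 0ℤ
jacobi a (suc n) = foldr ℤ._*_ 1ℤ (map (legendre a) (factors (factorise (suc n))))

-- Let k ≡ r (mod m) be the pseudoprime, so g = gcd(r, m) divides k and k ∣ a (a^(k-1) - 1).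
-- The part g_a of g coprime to a divides a^(k-1) - 1, so l_a(g_a) ∣ k - 1, and hence
-- h ∣ (k - 1) - (k - r) = r - 1.  The cofactor g / g_a is coprime to a^(k-1) - 1
-- (a common divisor would enlarge g_a), so it divides a.  If g is even then so is k, and
-- a^k = (a^(k/2))² ≡ a (mod k) makes a a square modulo every prime factor of k that does
-- not divide a; hence (a / k_{2a}) = 1, with k itself as the witness.
module Submission where

open import Defs
open import Data.Nat as ℕ using (ℕ; zero; suc; _*_; _≤_; _<_; z≤n; s≤s; NonZero)
import Data.Nat.Properties as NP
open import Data.Nat.GCD using (gcd; gcd[m,n]∣m; gcd[m,n]∣n; gcd[m,n]≢0)
import Data.Nat.Divisibility as ℕD
open import Data.Nat.DivMod using (_%_; _/_; m≡m%n+[m/n]*n; m%n<n)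
open import Data.Nat.Coprimality as C using (Coprime)
open import Data.Nat.Primality using (Prime; ¬prime[1]; prime⇒nonZero; composite⇒nonTrivial)
open import Data.Nat.Primality.Factorisation using (factorise; PrimeFactorisation)
open import Data.Nat.ListAction.Properties using (∈⇒∣product)
open import Data.Integer as ℤ using (ℤ; +_; _-_; 0ℤ; 1ℤ)
open import Data.Integer.Divisibility using (_∣_)
import Data.Integer.Properties as ZP
import Data.Integer.Divisibility.Signed as S
import Data.Integer.Coprimality as ZC
open import Data.Integer.Tactic.RingSolver using (solve-∀)
open import Data.List using (foldr)
open import Data.List.Relation.Unary.All as All using (All; []; _∷_)
open import Data.List.Relation.Unary.All.Properties using (map⁺)
open import Data.Product using (∃; _×_; _,_)
open import Data.Sum using (inj₂)
open import Data.Empty using (⊥-elim)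
open import Relation.Nullary using (¬_; yes; no)
open import Relation.Binary.PropositionalEquality

pos-^ : ∀ a j → (+ a) ℤ.^ j ≡ + (a ℕ.^ j)
pos-^ a zero    = refl
pos-^ a (suc j) = trans (cong (+ a ℤ.*_) (pos-^ a j)) (sym (ZP.pos-* a (a ℕ.^ j)))

x*y-1≡x*[y-1]+[x-1] : ∀ x y → x ℤ.* y - 1ℤ ≡ x ℤ.* (y - 1ℤ) ℤ.+ (x - 1ℤ)
x*y-1≡x*[y-1]+[x-1] = solve-∀

x-1∣x^q-1 : ∀ {d} x q → d S.∣ x - 1ℤ → d S.∣ x ℤ.^ q - 1ℤ
x-1∣x^q-1 {d} x zero    _      = S.divides 0ℤ (sym (ZP.*-zeroˡ d))
x-1∣x^q-1 {d} x (suc q) d∣x-1 = subst (d S.∣_) (sym (x*y-1≡x*[y-1]+[x-1] x (x ℤ.^ q)))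
  (S.∣m∣n⇒∣m+n (S.∣n⇒∣m*n x (x-1∣x^q-1 x q d∣x-1)) d∣x-1)

order∣exponent : ∀ {a k t} e → IsOrder a k t → (+ k) S.∣ (+ a) ℤ.^ e - 1ℤ → t ℕD.∣ e
order∣exponent {a} {k} {t@(suc _)} e (_ , k∣a^t-1 , least) k∣a^e-1 =
  ℕD.m%n≡0⇒n∣m e t (below-order⇒0 (e % t) (m%n<n e t) k∣a^[e%t]-1)
  where
  open ≡-Reasoning
  a^e≡ : (+ a) ℤ.^ e ≡ (+ a) ℤ.^ (e % t) ℤ.* ((+ a) ℤ.^ t) ℤ.^ (e / t)
  a^e≡ = begin
    (+ a) ℤ.^ e
      ≡⟨ cong ((+ a) ℤ.^_) (trans (m≡m%n+[m/n]*n e t) (cong (e % t ℕ.+_) (NP.*-comm (e / t) t))) ⟩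
    (+ a) ℤ.^ (e % t ℕ.+ t * (e / t))
      ≡⟨ ZP.^-distribˡ-+-* (+ a) (e % t) (t * (e / t)) ⟩
    (+ a) ℤ.^ (e % t) ℤ.* (+ a) ℤ.^ (t * (e / t))
      ≡⟨ cong ((+ a) ℤ.^ (e % t) ℤ.*_) (sym (ZP.^-*-assoc (+ a) t (e / t))) ⟩
    (+ a) ℤ.^ (e % t) ℤ.* ((+ a) ℤ.^ t) ℤ.^ (e / t) ∎
  k∣a^[e%t]-1 : (+ k) S.∣ (+ a) ℤ.^ (e % t) - 1ℤ
  k∣a^[e%t]-1 = S.∣m+n∣m⇒∣n
    (subst ((+ k) S.∣_) (trans (cong (_- 1ℤ) a^e≡) (x*y-1≡x*[y-1]+[x-1] a^[e%t] (a^t ℤ.^ (e / t)))) k∣a^e-1)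
    (S.∣n⇒∣m*n a^[e%t] (x-1∣x^q-1 a^t (e / t) (S.∣ᵤ⇒∣ k∣a^t-1)))
    where
    a^[e%t] = (+ a) ℤ.^ (e % t)
    a^t     = (+ a) ℤ.^ t
  below-order⇒0 : ∀ s → s < t → (+ k) S.∣ (+ a) ℤ.^ s - 1ℤ → s ≡ 0
  below-order⇒0 zero    _   _      = refl
  below-order⇒0 (suc s) s<t k∣a^s-1 =
    ⊥-elim (NP.<⇒≱ s<t (least (suc s) (s≤s z≤n) (S.∣⇒∣ᵤ k∣a^s-1)))

coprime-* : ∀ {m n c} → Coprime m c → Coprime n c → Coprime (m * n) c
coprime-* {m} {n} m⊥c n⊥c {e} (e∣mn , e∣c) =
  m⊥c (C.coprime-divisor e⊥n (subst (e ℕD.∣_) (NP.*-comm m n) e∣mn) , e∣c)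
  where
  e⊥n : Coprime e n
  e⊥n (f∣e , f∣n) = n⊥c (f∣n , ℕD.∣-trans f∣e e∣c)

∣a^[1+e]-1⇒coprime : ∀ {n a} e → (+ n) S.∣ (+ a) ℤ.^ suc e - 1ℤ → Coprime n a
∣a^[1+e]-1⇒coprime {a = a} e n∣a^[1+e]-1 {c} (c∣n , c∣a) =
  ℕD.∣1⇒≡1 (S.∣⇒∣ᵤ (subst ((+ c) S.∣_) (y-[y-1]≡1 ((+ a) ℤ.^ suc e))
    (S.∣m∣n⇒∣m-n (S.∣m⇒∣m*n ((+ a) ℤ.^ e) (S.∣ᵤ⇒∣ {+ c} {+ a} c∣a))
                 (S.∣-trans (S.∣ᵤ⇒∣ {+ c} {+ _} c∣n) n∣a^[1+e]-1))))
  where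
  y-[y-1]≡1 : ∀ y → y - (y - 1ℤ) ≡ 1ℤ
  y-[y-1]≡1 = solve-∀

-- By maximality of g_c: d * g_c divides g and is coprime to c, so d * g_c ≤ g_c.
cofactor-coprime-divisor≡1 : ∀ {c g g-c q d} → g ≢ 0 → IsCoprimePart c g g-c →
  g ≡ q * g-c → d ℕD.∣ q → Coprime d c → d ≡ 1
cofactor-coprime-divisor≡1 {g = g} {g-c} {q} {d} g≢0 (g-c∣g , g-c⊥c , largest) g≡q*g-c d∣q d⊥c =
  NP.≤-antisym d≤1 (NP.n≢0⇒n>0 d≢0)
  where
  instance
    g-c≢0 : NonZero g-c
    g-c≢0 = ℕ.≢-nonZero (λ g-c≡0 → g≢0 (ℕD.0∣⇒≡0 (subst (ℕD._∣ g) g-c≡0 g-c∣g)))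
  d≢0 : d ≢ 0
  d≢0 d≡0 = g≢0 (trans g≡q*g-c (cong (_* g-c) (ℕD.0∣⇒≡0 (subst (ℕD._∣ q) d≡0 d∣q))))
  d*g-c∣g : d * g-c ℕD.∣ g
  d*g-c∣g = subst (d * g-c ℕD.∣_) (sym g≡q*g-c) (ℕD.*-monoˡ-∣ g-c d∣q)
  d≤1 : d ≤ 1
  d≤1 = NP.*-cancelʳ-≤ d 1 g-c
    (subst (d * g-c ≤_) (sym (NP.*-identityˡ g-c)) (largest (d * g-c) d*g-c∣g (coprime-* d⊥c g-c⊥c)))

legendre≡1 : ∀ {a p} → ¬ p ℕD.∣ ℤ.∣ a ∣ → QR a p → legendre a p ≡ 1ℤ
legendre≡1 {a} {p} p∤a qr with p ℕD.∣? ℤ.∣ a ∣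
... | yes p∣a = ⊥-elim (p∤a p∣a)
... | no _ with QR? a p
...   | yes _  = refl
...   | no ¬qr = ⊥-elim (¬qr qr)

square⇒QR : ∀ {a p} y .{{_ : NonZero p}} → (+ p) S.∣ + y ℤ.* + y - a → QR a p
square⇒QR {a} {p} y p∣y²-a =
  x , m%n<n y p , S.∣⇒∣ᵤ (subst ((+ p) S.∣_) (x²-a≡ (+ y) (+ x) a)
    (S.∣m∣n⇒∣m-n p∣y²-a (S.∣m⇒∣m*n (+ y ℤ.+ + x) (S.divides (+ (y / p)) y-x≡))))
  where
  open ≡-Reasoning
  x = y % p
  y-x≡ : + y - + x ≡ + (y / p) ℤ.* + p
  y-x≡ = begin
    + y - + x                   ≡⟨ cong (λ z → + z - + x) (m≡m%n+[m/n]*n y p) ⟩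
    + (x ℕ.+ y / p * p) - + x   ≡⟨ cong (_- + x) (ZP.pos-+ x (y / p * p)) ⟩
    + x ℤ.+ + (y / p * p) - + x ≡⟨ [u+v]-u≡v (+ x) (+ (y / p * p)) ⟩
    + (y / p * p)               ≡⟨ ZP.pos-* (y / p) p ⟩
    + (y / p) ℤ.* + p           ∎
    where
    [u+v]-u≡v : ∀ u v → u ℤ.+ v - u ≡ v
    [u+v]-u≡v = solve-∀
  x²-a≡ : ∀ y x a → (y ℤ.* y - a) - (y - x) ℤ.* (y ℤ.+ x) ≡ x ℤ.* x - a
  x²-a≡ = solve-∀

product-of-ones : ∀ {xs} → All (_≡ 1ℤ) xs → foldr ℤ._*_ 1ℤ xs ≡ 1ℤ
product-of-ones []          = refl
product-of-ones (refl ∷ ps) = trans (ZP.*-identityˡ _) (product-of-ones ps)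

jacobi-square≡1 : ∀ {a} n y .{{_ : NonZero n}} → Coprime n ℤ.∣ a ∣ →
  (+ n) S.∣ + y ℤ.* + y - a → jacobi a n ≡ 1ℤ
jacobi-square≡1 {a} n@(suc _) y n⊥a n∣y²-a =
  product-of-ones (map⁺ (All.tabulate λ p∈F → legendre-factor≡1
    (All.lookup (PrimeFactorisation.factorsPrime F) p∈F)
    (subst (_ ℕD.∣_) (sym (PrimeFactorisation.isFactorisation F)) (∈⇒∣product p∈F))))
  where
  F = factorise n
  legendre-factor≡1 : ∀ {p} → Prime p → p ℕD.∣ n → legendre a p ≡ 1ℤ
  legendre-factor≡1 {p} p-prime p∣n = legendre≡1 p∤a
    (square⇒QR y {{prime⇒nonZero p-prime}} (S.∣-trans (S.∣ᵤ⇒∣ {+ p} {+ n} p∣n) n∣y²-a))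
    where
    p∤a : ¬ p ℕD.∣ ℤ.∣ a ∣
    p∤a p∣a = ¬prime[1] (subst Prime (n⊥a (p∣n , p∣a)) p-prime)

x*y-x≡x*[y-1] : ∀ x y → x ℤ.* y - x ≡ x ℤ.* (y - 1ℤ)
x*y-x≡x*[y-1] = solve-∀

gcd[∣r∣,m]∣k : ∀ {r m k} → (+ m) S.∣ + k - r → gcd ℤ.∣ r ∣ m ℕD.∣ k
gcd[∣r∣,m]∣k {r} {m} {k} m∣k-r = S.∣⇒∣ᵤ (subst ((+ gcd ℤ.∣ r ∣ m) S.∣_) ([k-r]+r≡k (+ k) r)
  (S.∣m∣n⇒∣m+n (S.∣-trans (S.∣ᵤ⇒∣ (gcd[m,n]∣n ℤ.∣ r ∣ m)) m∣k-r) (S.∣ᵤ⇒∣ (gcd[m,n]∣m ℤ.∣ r ∣ m))))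
  where
  [k-r]+r≡k : ∀ k r → (k - r) ℤ.+ r ≡ k
  [k-r]+r≡k = solve-∀

gcd[order,m]∣r-1 : ∀ {a d t m r} e → (+ m) S.∣ + suc e - r →
  (+ d) S.∣ (+ a) ℤ.^ suc e - + a → Coprime d a → IsOrder a d t → (+ gcd t m) S.∣ r - 1ℤ
gcd[order,m]∣r-1 {a} {d} {t} {m} {r} e m∣1+e-r d∣a^[1+e]-a d⊥a t-order =
  subst ((+ gcd t m) S.∣_) (e-[1+e-r]≡r-1 (+ e) r)
    (S.∣m∣n⇒∣m-n (S.∣ᵤ⇒∣ {+ gcd t m} {+ e} (ℕD.∣-trans (gcd[m,n]∣m t m) t∣e))
                 (S.∣-trans (S.∣ᵤ⇒∣ (gcd[m,n]∣n t m)) m∣1+e-r))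
  where
  d∣a^e-1 : (+ d) S.∣ (+ a) ℤ.^ e - 1ℤ
  d∣a^e-1 = S.∣ᵤ⇒∣ (ZC.coprime-divisor (+ d) (+ a) _ d⊥a
    (S.∣⇒∣ᵤ (subst ((+ d) S.∣_) (x*y-x≡x*[y-1] (+ a) ((+ a) ℤ.^ e)) d∣a^[1+e]-a)))
  t∣e : t ℕD.∣ e
  t∣e = order∣exponent e t-order d∣a^e-1
  e-[1+e-r]≡r-1 : ∀ e r → e - ((1ℤ ℤ.+ e) - r) ≡ r - 1ℤ
  e-[1+e-r]≡r-1 = solve-∀

cofactor∣base : ∀ {a g g-a q} e → g ≢ 0 → IsCoprimePart a g g-a → g ≡ q * g-a →
  (+ g) S.∣ (+ a) ℤ.^ suc (suc e) - + a → q ℕD.∣ a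
cofactor∣base {a} {g} {g-a} {q} e g≢0 g-a-part g≡q*g-a g∣a^[2+e]-a =
  C.coprime-divisor q⊥A (ℕD.∣-trans q∣g g∣A*a)
  where
  A = (+ a) ℤ.^ suc e - 1ℤ
  q⊥A : Coprime q ℤ.∣ A ∣
  q⊥A = C.gcd≡1⇒coprime (cofactor-coprime-divisor≡1 g≢0 g-a-part g≡q*g-a (gcd[m,n]∣m q ℤ.∣ A ∣)
    (∣a^[1+e]-1⇒coprime e (S.∣ᵤ⇒∣ {+ gcd q ℤ.∣ A ∣} {A} (gcd[m,n]∣n q ℤ.∣ A ∣))))
  q∣g : q ℕD.∣ g
  q∣g = subst (q ℕD.∣_) (sym g≡q*g-a) (ℕD.m∣m*n g-a)
  g∣A*a : g ℕD.∣ ℤ.∣ A ∣ * a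
  g∣A*a = subst (g ℕD.∣_) (trans (ZP.abs-* (+ a) A) (NP.*-comm a ℤ.∣ A ∣))
    (S.∣⇒∣ᵤ (subst ((+ g) S.∣_) (x*y-x≡x*[y-1] (+ a) ((+ a) ℤ.^ suc e)) g∣a^[2+e]-a))

even-exponent⇒square : ∀ {a k} → 2 ℕD.∣ k → (+ k) S.∣ (+ a) ℤ.^ k - + a →
  ∃ λ y → (+ k) S.∣ + y ℤ.* + y - + a
even-exponent⇒square {a} {k} 2∣k k∣a^k-a =
  y , subst (λ z → (+ k) S.∣ z - + a) a^k≡y*y k∣a^k-a
  where
  open ≡-Reasoning
  j = ℕD.quotient 2∣k
  y = a ℕ.^ j
  a^k≡y*y : (+ a) ℤ.^ k ≡ + y ℤ.* + y
  a^k≡y*y = begin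
    (+ a) ℤ.^ k             ≡⟨ cong ((+ a) ℤ.^_) (ℕD.m∣n⇒n≡quotient*m 2∣k) ⟩
    (+ a) ℤ.^ (j * 2)       ≡⟨ sym (ZP.^-*-assoc (+ a) j 2) ⟩
    ((+ a) ℤ.^ j) ℤ.^ 2     ≡⟨ cong (λ z → z ℤ.^ 2) (pos-^ a j) ⟩
    (+ y) ℤ.^ 2             ≡⟨ cong (+ y ℤ.*_) (ZP.*-identityʳ (+ y)) ⟩
    + y ℤ.* + y             ∎

mainTheorem7 : (a : ℕ) (r : ℤ) (m : ℕ) → 2 ≤ a → 0 < m →
    (∃ λ (n : ℤ) → (n ≡ r [mod m ]) × Pseudoprime (+ a) n) →
    ((∀ ga t → IsCoprimePart a (gcd ℤ.∣ r ∣ m) ga → IsOrder a ga t →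
        (+ gcd t m) ∣ (r - 1ℤ))
    × (∀ ga q → IsCoprimePart a (gcd ℤ.∣ r ∣ m) ga → gcd ℤ.∣ r ∣ m ≡ q * ga →
        ℕD._∣_ q a)
    × (ℕD._∣_ 2 (gcd ℤ.∣ r ∣ m) →
        ∃ λ (k : ℕ) → 1 ≤ k × ((+ k) ≡ r [mod m ])
          × (∀ k' → IsCoprimePart (2 * a) k k' → jacobi (+ a) k' ≡ 1ℤ)))
mainTheorem7 a r m _ 0<m (_ , k≡r , k , refl , k-composite , a^k≡a)
  with ℕ.nonTrivial⇒n>1 k {{composite⇒nonTrivial k-composite}}
... | s≤s (s≤s (z≤n {e})) =
    (λ g-a t (g-a∣g , g-a⊥a , _) t-order →
       S.∣⇒∣ᵤ (gcd[order,m]∣r-1 {r = r} (suc e) m∣k-r (∣k⇒∣a^k-a (ℕD.∣-trans g-a∣g g∣k)) g-a⊥a t-order))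
  , (λ g-a q g-a-part g≡q*g-a → cofactor∣base e g≢0 g-a-part g≡q*g-a (∣k⇒∣a^k-a g∣k))
  , λ 2∣g → k , s≤s z≤n , k≡r , λ k' (k'∣k , k'⊥2a , _) →
      let y , k∣y²-a = even-exponent⇒square (ℕD.∣-trans 2∣g g∣k) (∣k⇒∣a^k-a ℕD.∣-refl)
      in jacobi-square≡1 k' y {{ℕ.≢-nonZero (∣k⇒≢0 k'∣k)}}
           (λ (c∣k' , c∣a) → k'⊥2a (c∣k' , ℕD.∣n⇒∣m*n 2 c∣a))
           (S.∣-trans (S.∣ᵤ⇒∣ {+ k'} {+ k} k'∣k) k∣y²-a)
  where
  m∣k-r : (+ m) S.∣ + k - r
  m∣k-r = S.∣ᵤ⇒∣ k≡r
  g∣k : gcd ℤ.∣ r ∣ m ℕD.∣ k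
  g∣k = gcd[∣r∣,m]∣k {r} m∣k-r
  g≢0 : gcd ℤ.∣ r ∣ m ≢ 0
  g≢0 = gcd[m,n]≢0 ℤ.∣ r ∣ m (inj₂ (NP.n>0⇒n≢0 0<m))
  ∣k⇒∣a^k-a : ∀ {d} → d ℕD.∣ k → (+ d) S.∣ (+ a) ℤ.^ k - + a
  ∣k⇒∣a^k-a d∣k = S.∣-trans (S.∣ᵤ⇒∣ {+ _} {+ k} d∣k) (S.∣ᵤ⇒∣ a^k≡a)
  ∣k⇒≢0 : ∀ {d} → d ℕD.∣ k → d ≢ 0
  ∣k⇒≢0 d∣k refl with () ← ℕD.0∣⇒≡0 d∣k
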